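{- In intensional Martin-Löf type theory, assume that every type has a constant endofunction, i.e. $\prod_{A:\mathcal U}\sum_{k:A\to A}\prod_{a,b:A}k(a)=k(b)$. Then for every type $X:\mathcal U$ and every relation $R:X\times X\to\mathcal U$ there is a relation $S:X\times X\to\mathcal U$ such that: (i) $S$ is propositionally valued: $\prod_{x,y:X}\mathrm{isProp}(S(x,y))$; (ii) $S$ is functional: $\prod_{x:X}\mathrm{isProp}\big(\sum_{y:X}S(x,y)\big)$; (iii) $S$ is a subrelation of $R$: $\prod_{x,y:X}S(x,y)\to R(x,y)$; (iv) $S$ and $R$ have the same domain: for every $x:X$, $\big(\sum_{y:X}R(x,y)\big)\Leftrightarrow\big(\sum_{y:X}S(x,y)\big)$.
   Context: Intensional Martin-Löf type theory with a universe $\mathcal U$ (and a larger universe containing it as needed), $\Sigma$, $\Pi$, $+$, $\mathbf 0$, $\mathbf 2$ and identity types (J only; no UIP/K). $\mathrm{isProp}(A):\equiv\prod_{a,b:A}a=b$. $A\Leftrightarrow B$ means there are maps in both directions. -}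

{-# OPTIONS --without-K #-}
module Defs where

open import Data.Product using (Σ; _×_; _,_)
open import Relation.Binary.PropositionalEquality using (_≡_)

isProp : Set → Set
isProp A = (a b : A) → a ≡ b

_⇔_ : Set → Set → Set
A ⇔ B = (A → B) × (B → A)

AllTypesHaveConstEndo : Set₁
AllTypesHaveConstEndo =
  (A : Set) → Σ (A → A) (λ k → (a b : A) → k a ≡ k b)

{-# OPTIONS --without-K #-}
-- The fixed points of a weakly constant endofunction form a proposition, so
-- under the hypothesis every type A is logically equivalent to the proposition
-- ‖ A ‖ of fixed points of its constant endofunction.  For x : X choose, via
-- ‖ Σ y R (x , y) ‖, one canonical R-successor of x; then S (x , y) says that
-- this canonical successor is y.  The identity type of X need not be a
-- proposition, so that statement is itself squashed once more.
module Submission where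

open import Defs
open import Data.Product using (Σ; _×_; _,_; proj₁; proj₂)
open import Data.Product.Properties using (Σ-≡,≡→≡)
open import Relation.Binary.PropositionalEquality
open import Relation.Binary.PropositionalEquality.Properties using (trans-symˡ; trans-reflʳ)

trans-cancelˡ : {A : Set} {x y z : A} (p : x ≡ y) (q : x ≡ z) →
                trans p (trans (sym p) q) ≡ q
trans-cancelˡ refl q = refl

isProp-Σ : {A : Set} {B : A → Set} → ((a : A) → isProp (B a)) →
           ((u v : Σ A B) → proj₁ u ≡ proj₁ v) → isProp (Σ A B)
isProp-Σ B-isProp proj₁-≡ u v = Σ-≡,≡→≡ (proj₁-≡ u v , B-isProp _ _ _)

Fix : {A : Set} → (A → A) → Set
Fix {A} f = Σ A (λ a → f a ≡ a)

Fix-≡ : {A : Set} {f : A → A} {a b : A} {p : f a ≡ a} {q : f b ≡ b}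
        (r : a ≡ b) → trans p r ≡ trans (cong f r) q →
        _≡_ {A = Fix f} (a , p) (b , q)
Fix-≡ {p = p} refl square = cong (_ ,_) (trans (sym (trans-reflʳ p)) square)

module WeaklyConstant {A : Set} (f : A → A) (const : (a b : A) → f a ≡ f b) where

  -- Unlike const a a, const′ a a is refl up to trans-symˡ, which is what lets
  -- path induction identify cong f r with it.
  const′ : (a b : A) → f a ≡ f b
  const′ a b = trans (sym (const a a)) (const a b)

  cong-const : {a b : A} (r : a ≡ b) → cong f r ≡ const′ a b
  cong-const {a} refl = sym (trans-symˡ (const a a))

  Fix-isProp : isProp (Fix f)
  Fix-isProp (a , p) (b , q) = Fix-≡ r (begin
      trans p r                 ≡⟨ trans-cancelˡ p _ ⟩
      trans (const′ a b) q      ≡⟨ cong (λ s → trans s q) (sym (cong-const r)) ⟩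
      trans (cong f r) q        ∎)
    where
    open ≡-Reasoning
    r : a ≡ b
    r = trans (sym p) (trans (const′ a b) q)

  toFix : A → Fix f
  toFix a = f a , const (f a) a

module Squash (constEndo : AllTypesHaveConstEndo) where

  private
    module W (A : Set) = WeaklyConstant (proj₁ (constEndo A)) (proj₂ (constEndo A))

  ‖_‖ : Set → Set
  ‖ A ‖ = Fix (proj₁ (constEndo A))

  ‖‖-isProp : (A : Set) → isProp ‖ A ‖
  ‖‖-isProp A = W.Fix-isProp A

  ∣_∣ : {A : Set} → A → ‖ A ‖
  ∣_∣ {A} = W.toFix A

  unsquash : {A : Set} → ‖ A ‖ → A
  unsquash = proj₁

module FunctionalSubrelation (constEndo : AllTypesHaveConstEndo)
                             {X : Set} (R : X × X → Set) where

  open Squash constEndo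

  Dom : X → Set
  Dom x = Σ X (λ y → R (x , y))

  successor : {x : X} → ‖ Dom x ‖ → X
  successor t = proj₁ (unsquash t)

  CanonicalSuccessor : X → X → Set
  CanonicalSuccessor x y = Σ ‖ Dom x ‖ (λ t → successor t ≡ y)

  S : X × X → Set
  S (x , y) = ‖ CanonicalSuccessor x y ‖

  S-isProp : (x y : X) → isProp (S (x , y))
  S-isProp x y = ‖‖-isProp _

  S-functional : (x : X) → isProp (Σ X (λ y → S (x , y)))
  S-functional x = isProp-Σ (S-isProp x) targets-≡
    where
    targets-≡ : (u v : Σ X (λ y → S (x , y))) → proj₁ u ≡ proj₁ v
    targets-≡ (y , s) (y′ , s′) with unsquash s | unsquash s′
    ... | t , t↦y | t′ , t′↦y′ =
      trans (sym t↦y) (trans (cong successor (‖‖-isProp (Dom x) t t′)) t′↦y′)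

  S⊆R : (x y : X) → S (x , y) → R (x , y)
  S⊆R x y s with unsquash s
  ... | t , t↦y = subst (λ z → R (x , z)) t↦y (proj₂ (unsquash t))

  Dom⇔S-Dom : (x : X) → Dom x ⇔ Σ X (λ y → S (x , y))
  Dom⇔S-Dom x = (λ d → let t = ∣ d ∣ in successor t , ∣ t , refl ∣)
              , (λ { (y , s) → y , S⊆R x y s })

theorem7p3 : AllTypesHaveConstEndo →
    (X : Set) (R : X × X → Set) →
    Σ (X × X → Set) (λ S →
      ((x y : X) → isProp (S (x , y)))
      × ((x : X) → isProp (Σ X (λ y → S (x , y))))
      × ((x y : X) → S (x , y) → R (x , y))
      × ((x : X) → Σ X (λ y → R (x , y)) ⇔ Σ X (λ y → S (x , y))))
theorem7p3 constEndo X R = S , S-isProp , S-functional , S⊆R , Dom⇔S-Dom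
  where open FunctionalSubrelation constEndo R
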